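{- Let $D$ be a contractible separating decomposition of a quadrangulation $Q$, and remove from $Q$ the path of length 2 going from $s$ to $t$ that has the outer face on its left (obtaining a separating decomposition with one fewer inner face). Then on the contour of each inner face of the resulting map there is exactly one blue edge going from a black vertex to a white vertex.
   Context: A quadrangulation is a planar map (connected graph embedded in the plane, up to isotopy) with no loop nor multiple edge in which every face, including the outer one, has degree 4; its vertices are properly bicolored black and white. Its outer face has vertices $s$, $w_1$, $t$, $w_2$ in cyclic order, with $s,t$ black and $w_1,w_2$ white. A separating decomposition of $Q$ is an orientation and red/blue coloring of all edges such that: (i) each vertex other than $s,t$ has exactly one outgoing red edge and one outgoing blue edge; (ii) around each such black vertex, incoming edges of each color follow the outgoing edge of that color in clockwise order, and around each such white vertex in counterclockwise order; (iii) all edges at $s$ are incoming blue and all edges at $t$ are incoming red. The separating decomposition is contractible if each white vertex other than $w_1,w_2$ has exactly one incoming blue edge, and $w_1,w_2$ have no incoming blue edge. -}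

module Defs where

open import Data.Nat using (ℕ; zero; suc; _+_; _*_; _≤ᵇ_)
open import Data.Bool using (Bool; true; false; not; if_then_else_)
open import Data.Fin using (Fin; toℕ)
open import Data.List.Base using (List; map; upTo; allFin)
open import Data.Bool.ListAction using (and)
open import Data.Nat.ListAction using (sum)
open import Data.Product using (Σ; ∃; ∃-syntax; _×_; _,_)
open import Data.Sum using (_⊎_)
open import Relation.Nullary using (¬_)
open import Relation.Binary.PropositionalEquality using (_≡_; _≢_)
open import Relation.Binary.Construct.Closure.ReflexiveTransitive using (Star)

iter : {A : Set} → (A → A) → ℕ → A → A
iter f zero    x = x
iter f (suc k) x = f (iter f k x)

ExactlyOne : {A : Set} → (A → Set) → Set
ExactlyOne {A} P = Σ A λ x → P x × (∀ y → P y → y ≡ x)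

-- number of orbits of a map p : Fin n → Fin n (meant for permutations):
-- count the darts that are minimal (w.r.t. toℕ) in their orbit.
orbitMin : {n : ℕ} → (Fin n → Fin n) → Fin n → Bool
orbitMin {n} p d = and (map (λ k → toℕ d ≤ᵇ toℕ (iter p k d)) (upTo n))

numOrbits : {n : ℕ} → (Fin n → Fin n) → ℕ
numOrbits {n} p = sum (map (λ d → if orbitMin p d then 1 else 0) (allFin n))

-- Combinatorial maps on darts Fin n.
-- α : fixed-point-free involution (the two darts/half-edges of an edge),
-- σ : the counterclockwise rotation of darts around their origin vertex.
-- Vertices = σ-orbits, edges = α-orbits, faces = orbits of φ = σ ∘ α.
-- With σ counterclockwise, following d, φ d, φ² d, … walks along the
-- contour of a face keeping that face on the RIGHT.

record Map (n : ℕ) : Set where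
  field
    α σ σ⁻ : Fin n → Fin n
    α-invol : ∀ d → α (α d) ≡ d
    α-free  : ∀ d → α d ≢ d
    σ-left  : ∀ d → σ⁻ (σ d) ≡ d
    σ-right : ∀ d → σ (σ⁻ d) ≡ d

  φ : Fin n → Fin n
  φ d = σ (α d)

  SameVertex : Fin n → Fin n → Set
  SameVertex d e = ∃[ k ] iter σ k d ≡ e

  InFace : Fin n → Fin n → Set
  InFace d e = ∃[ k ] iter φ k d ≡ e

  data Step : Fin n → Fin n → Set where
    σ-step : ∀ d → Step d (σ d)
    α-step : ∀ d → Step d (α d)

  Connected : Set
  Connected = ∀ d e → Star Step d e

  -- Euler's formula V - E + F = 2, with E = n / 2
  Planar : Set
  Planar = 2 * (numOrbits σ + numOrbits φ) ≡ n + 4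

-- Quadrangulations with outer face s, w1, t, w2.
-- `root` is the dart of the outer face leaving s; then
-- φ root leaves one outer white vertex, φ² root leaves t,
-- φ³ root leaves the other outer white vertex.

record Quadrangulation (n : ℕ) : Set where
  field
    M : Map n
  open Map M public
  field
    connected : Connected
    planar    : Planar
    noLoop    : ∀ d → ¬ SameVertex d (α d)
    noMulti   : ∀ d e → SameVertex d e → SameVertex (α d) (α e) → d ≡ e
    degree4   : ∀ d → (iter φ 4 d ≡ d) × (iter φ 2 d ≢ d)
    root      : Fin n
    -- proper bicolouring of the vertices (true = black)
    black     : Fin n → Bool
    black-σ   : ∀ d → black (σ d) ≡ black d
    black-α   : ∀ d → black (α d) ≡ not (black d)
    s-black   : black root ≡ true

  AtS AtT AtW : Fin n → Set
  AtS d = SameVertex root d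
  AtT d = SameVertex (iter φ 2 root) d
  AtW d = SameVertex (φ root) d ⊎ SameVertex (iter φ 3 root) d

data Colour : Set where
  red blue : Colour

-- Separating decompositions.  out d = true means the edge of d is
-- oriented away from the origin of d.

record SepDec {n : ℕ} (Q : Quadrangulation n) : Set where
  open Quadrangulation Q
  field
    out   : Fin n → Bool
    out-α : ∀ d → out (α d) ≡ not (out d)
    col   : Fin n → Colour
    col-α : ∀ d → col (α d) ≡ col d
    one-out-red  : ∀ d → ¬ AtS d → ¬ AtT d →
      ExactlyOne (λ e → SameVertex d e × out e ≡ true × col e ≡ red)
    one-out-blue : ∀ d → ¬ AtS d → ¬ AtT d →
      ExactlyOne (λ e → SameVertex d e × out e ≡ true × col e ≡ blue)
    -- (ii) clockwise = σ⁻ direction.  At a black vertex, in clockwise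
    -- order each incoming dart is preceded by a dart of its colour
    -- (an incoming one or the outgoing one of that colour);
    -- at a white vertex the same in counterclockwise order.
    black-rot : ∀ d → ¬ AtS d → ¬ AtT d → black d ≡ true →
      out d ≡ false → col (σ d) ≡ col d
    white-rot : ∀ d → ¬ AtS d → ¬ AtT d → black d ≡ false →
      out d ≡ false → col (σ⁻ d) ≡ col d
    at-s : ∀ d → AtS d → (out d ≡ false) × (col d ≡ blue)
    at-t : ∀ d → AtT d → (out d ≡ false) × (col d ≡ red)

module _ {n : ℕ} {Q : Quadrangulation n} (D : SepDec Q) where
  open Quadrangulation Q
  open SepDec D

  Contractible : Set
  Contractible =
    (∀ d → black d ≡ false → ¬ AtW d →
      ExactlyOne (λ e → SameVertex d e × out e ≡ false × col e ≡ blue))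
    × (∀ d → AtW d → ¬ ((out d ≡ false) × (col d ≡ blue)))

  -- d is the dart of its edge pointing along the orientation, it leaves
  -- a black vertex (hence ends at a white one) and the edge is blue.
  BlackToWhiteBlue : Fin n → Set
  BlackToWhiteBlue e = (out e ≡ true) × (black e ≡ true) × (col e ≡ blue)

-- The path of length 2 from s to t with the outer face on its left is
-- s → (origin of φ³ root) → t, made of the edges of φ³ root and φ² root.
-- Deleting these two edges merges the outer face with the inner face(s)
-- on the other side of the path; the inner faces of the resulting map
-- are exactly the inner faces of Q containing neither α (φ² root) nor
-- α (φ³ root).
InnerFaceAfterRemoval : {n : ℕ} (Q : Quadrangulation n) → Fin n → Set
InnerFaceAfterRemoval Q d =
  ¬ InFace root d × ¬ InFace d (α (iter φ 2 root)) × ¬ InFace d (α (iter φ 3 root))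
  where open Quadrangulation Q

-- Around a black vertex the colour changes, from a dart to its counterclockwise successor,
-- exactly after the outgoing darts; around a white vertex exactly before them.
-- Contractibility adds that at a white vertex a blue dart is followed by a dart of the
-- opposite orientation, except at the two corners of w₁ and w₂ lying on the outer face and
-- on the face across the removed path.  On a face of degree 4 these local rules leave
-- finitely many labellings of the four edges, each with exactly one blue edge oriented from
-- black to white, which is checked by enumeration.
module Submission where

open import Defs
open import Data.Nat using (ℕ; zero; suc; _+_; _*_; _∸_; NonZero)
open import Data.Nat.DivMod using (_%_; _/_; m%n<n; m≡m%n+[m/n]*n)
open import Data.Nat.Properties using (+-suc; m+[n∸m]≡n; m∸n+n≡m; m≤m*n; n<1+n)
open import Data.Bool using (Bool; true; false; not; _∧_; _∨_; _xor_; T; if_then_else_)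
open import Data.Bool.Properties using (T-∧; xor-same; xor-inverseʳ; xor-inverseˡ; not-¬)
open import Data.Fin using (Fin; zero; suc; toℕ; fromℕ<)
open import Data.Fin.Properties using (pigeonhole; toℕ-fromℕ<)
open import Data.Vec using (Vec; []; _∷_)
open import Data.Product using (Σ; ∃-syntax; _×_; _,_; proj₁; proj₂; curry)
open import Data.Sum using (_⊎_; inj₁; inj₂)
open import Data.Empty using (⊥; ⊥-elim)
open import Data.Unit using (tt)
open import Function using (_∘_)
open import Function.Bundles using (Equivalence)
open import Relation.Nullary using (¬_; yes; no)
open import Relation.Binary.Definitions using (DecidableEquality)
open import Relation.Binary.PropositionalEquality

module _ {A : Set} (f : A → A) where

  iter-+ : ∀ k m x → iter f (k + m) x ≡ iter f k (iter f m x)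
  iter-+ zero    m x = refl
  iter-+ (suc k) m x = cong f (iter-+ k m x)

  iter-sucʳ : ∀ k x → iter f (suc k) x ≡ iter f k (f x)
  iter-sucʳ zero    x = refl
  iter-sucʳ (suc k) x = cong f (iter-sucʳ k x)

  iter-fixed : ∀ {x} → f x ≡ x → ∀ k → iter f k x ≡ x
  iter-fixed e zero    = refl
  iter-fixed e (suc k) = trans (cong f (iter-fixed e k)) e

  iter-*-period : ∀ {p x} → iter f p x ≡ x → ∀ k → iter f (k * p) x ≡ x
  iter-*-period         e zero    = refl
  iter-*-period {p} {x} e (suc k) = begin
    iter f (p + k * p) x         ≡⟨ iter-+ p (k * p) x ⟩
    iter f p (iter f (k * p) x)  ≡⟨ cong (iter f p) (iter-*-period e k) ⟩
    iter f p x                   ≡⟨ e ⟩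
    x                            ∎
    where open ≡-Reasoning

  iter-% : ∀ {p x} .{{_ : NonZero p}} → iter f p x ≡ x → ∀ k → iter f k x ≡ iter f (k % p) x
  iter-% {p} {x} e k = begin
    iter f k x                                ≡⟨ cong (λ m → iter f m x) (m≡m%n+[m/n]*n k p) ⟩
    iter f (k % p + (k / p) * p) x            ≡⟨ iter-+ (k % p) ((k / p) * p) x ⟩
    iter f (k % p) (iter f ((k / p) * p) x)   ≡⟨ cong (iter f (k % p)) (iter-*-period e (k / p)) ⟩
    iter f (k % p) x                          ∎
    where open ≡-Reasoning

  Reach : A → A → Set
  Reach x y = ∃[ k ] iter f k x ≡ y

  reach-trans : ∀ {x y z} → Reach x y → Reach y z → Reach x z
  reach-trans {x} (k , p) (m , q) = m + k , trans (iter-+ m k x) (trans (cong (iter f m) p) q)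

  reach-sym : ∀ {p x y} → iter f (suc p) x ≡ x → Reach x y → Reach y x
  reach-sym {p} {x} e (k , refl) = k * suc p ∸ k , (begin
    iter f (k * suc p ∸ k) (iter f k x)  ≡⟨ iter-+ (k * suc p ∸ k) k x ⟨
    iter f (k * suc p ∸ k + k) x         ≡⟨ cong (λ m → iter f m x) (m∸n+n≡m (m≤m*n k (suc p))) ⟩
    iter f (k * suc p) x                 ≡⟨ iter-*-period e k ⟩
    x                                    ∎)
    where open ≡-Reasoning

iter-cancel : ∀ {A : Set} (f g : A → A) → (∀ x → g (f x) ≡ x) → ∀ k x → iter g k (iter f k x) ≡ x
iter-cancel f g gf zero    x = refl
iter-cancel f g gf (suc k) x = begin
  g (iter g k (f (iter f k x)))  ≡⟨ cong (g ∘ iter g k) (iter-sucʳ f k x) ⟩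
  g (iter g k (iter f k (f x)))  ≡⟨ cong g (iter-cancel f g gf k (f x)) ⟩
  g (f x)                        ≡⟨ gf x ⟩
  x                              ∎
  where open ≡-Reasoning

-- Among the n + 1 points x, f x, …, fⁿ x two coincide, and f is injective.
iter-periodic : ∀ {n} (f g : Fin n → Fin n) → (∀ x → g (f x) ≡ x) → ∀ x → ∃[ q ] iter f (suc q) x ≡ x
iter-periodic {n} f g gf x with k , l , k<l , fᵏx≡fˡx ← pigeonhole (n<1+n n) (λ k → iter f (toℕ k) x) =
  q , (begin
    iter f (suc q) x                          ≡⟨ iter-cancel f g gf i (iter f (suc q) x) ⟨
    iter g i (iter f i (iter f (suc q) x))    ≡⟨ cong (iter g i) (iter-+ f i (suc q) x) ⟨
    iter g i (iter f (i + suc q) x)           ≡⟨ cong (λ m → iter g i (iter f m x)) i+[1+q]≡l ⟩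
    iter g i (iter f (toℕ l) x)               ≡⟨ cong (iter g i) fᵏx≡fˡx ⟨
    iter g i (iter f i x)                     ≡⟨ iter-cancel f g gf i x ⟩
    x                                         ∎)
  where
  open ≡-Reasoning
  i = toℕ k
  q = toℕ l ∸ suc i
  i+[1+q]≡l : i + suc q ≡ toℕ l
  i+[1+q]≡l = trans (+-suc i q) (m+[n∸m]≡n k<l)

_⇒_ : Bool → Bool → Bool
x ⇒ y = not x ∨ y

infixr 4 _⇒_

⇒-elim : ∀ {x y} → T (x ⇒ y) → T x → T y
⇒-elim {true} ty _ = ty

_,ᵀ_ : ∀ {x y} → T x → T y → T (x ∧ y)
_,ᵀ_ = curry (Equivalence.from T-∧)

infixr 4 _,ᵀ_

_==_ : Bool → Bool → Bool
x == y = not (x xor y)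

==-intro : ∀ {x y} → x ≡ y → T (x == y)
==-intro {x} refl rewrite xor-same x = tt

every : ∀ m → (Vec Bool m → Bool) → Bool
every zero    p = p []
every (suc m) p = every m (p ∘ (true ∷_)) ∧ every m (p ∘ (false ∷_))

every-sound : ∀ m (p : Vec Bool m → Bool) → T (every m p) → ∀ v → T (p v)
every-sound zero    p t []          = t
every-sound (suc m) p t (true  ∷ v) = every-sound m _ (proj₁ (Equivalence.to T-∧ t)) v
every-sound (suc m) p t (false ∷ v) = every-sound m _ (proj₂ (Equivalence.to T-∧ t)) v

noneᵇ : ∀ {m} → (Fin m → Bool) → Bool
noneᵇ {zero}  v = true
noneᵇ {suc m} v = not (v zero) ∧ noneᵇ (v ∘ suc)

exactlyOneᵇ : ∀ {m} → (Fin m → Bool) → Bool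
exactlyOneᵇ {zero}  v = false
exactlyOneᵇ {suc m} v = if v zero then noneᵇ (v ∘ suc) else exactlyOneᵇ (v ∘ suc)

noneᵇ-sound : ∀ {m} (v : Fin m → Bool) → T (noneᵇ v) → ∀ i → ¬ T (v i)
noneᵇ-sound {suc m} v t i with v zero in v₀
noneᵇ-sound {suc m} v t zero    | false = λ v₀′ → subst T v₀ v₀′
noneᵇ-sound {suc m} v t (suc i) | false = noneᵇ-sound (v ∘ suc) t i

exactlyOneᵇ-sound : ∀ {m} (v : Fin m → Bool) → T (exactlyOneᵇ v) → ExactlyOne (λ i → T (v i))
exactlyOneᵇ-sound {suc m} v t with v zero in v₀
... | true = zero , subst T (sym v₀) tt , only-zero
  where
  only-zero : ∀ i → T (v i) → i ≡ zero
  only-zero zero    _   = refl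
  only-zero (suc i) vᵢ = ⊥-elim (noneᵇ-sound (v ∘ suc) t i vᵢ)
... | false with i , vᵢ , only-i ← exactlyOneᵇ-sound (v ∘ suc) t = suc i , vᵢ , only-suc-i
  where
  only-suc-i : ∀ j → T (v j) → j ≡ suc i
  only-suc-i zero    v₀′ = ⊥-elim (subst T v₀ v₀′)
  only-suc-i (suc j) vⱼ  = cong suc (only-i j vⱼ)

isBlue : Colour → Bool
isBlue red  = false
isBlue blue = true

other : Colour → Colour
other red  = blue
other blue = red

other-≢ : ∀ c → other c ≢ c
other-≢ red  ()
other-≢ blue ()

_≟ᶜ_ : DecidableEquality Colour
red  ≟ᶜ red  = yes refl
red  ≟ᶜ blue = no λ ()
blue ≟ᶜ red  = no λ ()
blue ≟ᶜ blue = yes refl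

≢blue⇒red : ∀ {c} → c ≢ blue → c ≡ red
≢blue⇒red {red}  _ = refl
≢blue⇒red {blue} c≢blue = ⊥-elim (c≢blue refl)

colour-change : ∀ {o k k′} → (o ≡ false → k′ ≡ k) → (o ≡ true → k′ ≢ k) → isBlue k xor isBlue k′ ≡ o
colour-change {false} {k} keep _ rewrite keep refl = xor-same (isBlue k)
colour-change {true} {red}  {red}  _ switch = ⊥-elim (switch refl refl)
colour-change {true} {red}  {blue} _ _      = refl
colour-change {true} {blue} {red}  _ _      = refl
colour-change {true} {blue} {blue} _ switch = ⊥-elim (switch refl refl)

-- A corner is a pair of consecutive darts a, σ a around a vertex, described by the
-- colour of the vertex, the orientations o, o′ and the blueness k, k′ of a and σ a.
cornerᵇ : Bool → Bool → Bool → Bool → Bool → Bool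
cornerᵇ true  o k o′ k′ = (k xor k′) == o
cornerᵇ false o k o′ k′ = (k xor k′) == o′ ∧ (k ⇒ (o′ xor o))

-- b, o, k: origin colour, orientation and blueness of one dart of the edge.
btwEdgeᵇ : Bool → Bool → Bool → Bool
btwEdgeᵇ b o k = k ∧ (b == o)

-- bᵢ, oᵢ, kᵢ label the darts x₀ … x₃ of a face, φ xᵢ = xᵢ₊₁; the corner at the origin
-- of xᵢ₊₁ is (α xᵢ, xᵢ₊₁), and α reverses the orientation.
faceᵇ : Vec Bool 12 → Bool
faceᵇ (b₀ ∷ o₀ ∷ k₀ ∷ b₁ ∷ o₁ ∷ k₁ ∷ b₂ ∷ o₂ ∷ k₂ ∷ b₃ ∷ o₃ ∷ k₃ ∷ []) =
  (b₀ xor b₁) ∧ (b₁ xor b₂) ∧ (b₂ xor b₃) ∧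
  cornerᵇ b₁ (not o₀) k₀ o₁ k₁ ∧ cornerᵇ b₂ (not o₁) k₁ o₂ k₂ ∧
  cornerᵇ b₃ (not o₂) k₂ o₃ k₃ ∧ cornerᵇ b₀ (not o₃) k₃ o₀ k₀
  ⇒ exactlyOneᵇ edges
  where
  edges : Fin 4 → Bool
  edges zero                   = btwEdgeᵇ b₀ o₀ k₀
  edges (suc zero)             = btwEdgeᵇ b₁ o₁ k₁
  edges (suc (suc zero))       = btwEdgeᵇ b₂ o₂ k₂
  edges (suc (suc (suc zero))) = btwEdgeᵇ b₃ o₃ k₃

faceᵇ-valid : ∀ v → T (faceᵇ v)
faceᵇ-valid = every-sound 12 faceᵇ tt

exactlyOne-unique : ∀ {A : Set} {P : A → Set} {y z} → ExactlyOne P → P y → P z → y ≡ z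
exactlyOne-unique (_ , _ , only) py pz = trans (only _ py) (sym (only _ pz))

module _ {n : ℕ} {Q : Quadrangulation n} where
  open Quadrangulation Q

  vertex-trans : ∀ {x y z} → SameVertex x y → SameVertex y z → SameVertex x z
  vertex-trans = reach-trans σ

  vertex-sym : ∀ {x y} → SameVertex x y → SameVertex y x
  vertex-sym {x} with p , σᵖ⁺¹x≡x ← iter-periodic σ σ⁻ σ-left x = reach-sym σ {p} σᵖ⁺¹x≡x

  vertex-σ : ∀ x → SameVertex x (σ x)
  vertex-σ x = 1 , refl

  vertex-σ⁻ : ∀ x → SameVertex x (σ⁻ x)
  vertex-σ⁻ x = vertex-sym (1 , σ-right x)

  black-vertex : ∀ {x y} → SameVertex x y → black y ≡ black x
  black-vertex {x} (k , refl) = black-iter k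
    where
    black-iter : ∀ k → black (iter σ k x) ≡ black x
    black-iter zero    = refl
    black-iter (suc k) = trans (black-σ (iter σ k x)) (black-iter k)

  black-φ : ∀ x → black (φ x) ≡ not (black x)
  black-φ x = trans (black-σ (α x)) (black-α x)

  black-t : black (iter φ 2 root) ≡ true
  black-t rewrite black-φ (φ root) | black-φ root | s-black = refl

  white-¬AtS : ∀ {x} → black x ≡ false → ¬ AtS x
  white-¬AtS {x} bx s with () ← trans (sym s-black) (trans (sym (black-vertex s)) bx)

  white-¬AtT : ∀ {x} → black x ≡ false → ¬ AtT x
  white-¬AtT {x} bx t with () ← trans (sym black-t) (trans (sym (black-vertex t)) bx)

  white-w₁ : black (φ root) ≡ false
  white-w₁ rewrite black-φ root | s-black = refl

  white-w₂ : black (iter φ 3 root) ≡ false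
  white-w₂ rewrite black-φ (iter φ 2 root) | black-t = refl

  face-period : ∀ x → iter φ 4 x ≡ x
  face-period x = proj₁ (degree4 x)

  face-dart : ∀ d k → ∃[ i ] iter φ k d ≡ iter φ (toℕ {4} i) d
  face-dart d k = fromℕ< (m%n<n k 4) ,
    trans (iter-% φ (face-period d) k) (cong (λ m → iter φ m d) (sym (toℕ-fromℕ< (m%n<n k 4))))

  face-alternates : ∀ x → T (black x xor black (φ x))
  face-alternates x rewrite black-φ x | xor-inverseʳ (black x) = tt

  OnEdge : Fin n → Fin n → Set
  OnEdge x e = x ≡ e ⊎ x ≡ α e

  face⇒onEdge : ∀ {d e} → InFace d e ⊎ InFace d (α e) → ∃[ i ] OnEdge (iter φ (toℕ {4} i) d) e
  face⇒onEdge {d} (inj₁ (k , φᵏd≡e))  with i , φᵏd≡φⁱd ← face-dart d k =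
    i , inj₁ (trans (sym φᵏd≡φⁱd) φᵏd≡e)
  face⇒onEdge {d} (inj₂ (k , φᵏd≡αe)) with i , φᵏd≡φⁱd ← face-dart d k =
    i , inj₂ (trans (sym φᵏd≡φⁱd) φᵏd≡αe)

  module _ (D : SepDec Q) where
    open SepDec D

    outgoing-¬AtS : ∀ {x} → out x ≡ true → ¬ AtS x
    outgoing-¬AtS ox s with () ← trans (sym ox) (proj₁ (at-s _ s))

    outgoing-¬AtT : ∀ {x} → out x ≡ true → ¬ AtT x
    outgoing-¬AtT ox t with () ← trans (sym ox) (proj₁ (at-t _ t))

    one-outgoing : ∀ c x → ¬ AtS x → ¬ AtT x →
      ExactlyOne (λ e → SameVertex x e × out e ≡ true × col e ≡ c)
    one-outgoing red  = one-out-red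
    one-outgoing blue = one-out-blue

    outgoing-unique : ∀ {x y z} c → ¬ AtS x → ¬ AtT x →
      SameVertex x y → out y ≡ true → col y ≡ c →
      SameVertex x z → out z ≡ true → col z ≡ c → y ≡ z
    outgoing-unique c ¬s ¬t xy oy cy xz oz cz =
      exactlyOne-unique (one-outgoing c _ ¬s ¬t) (xy , oy , cy) (xz , oz , cz)

    -- Otherwise x would be the only dart of its vertex, which has two outgoing darts.
    σ-no-fixpoint : ∀ {x} → ¬ AtS x → ¬ AtT x → σ x ≢ x
    σ-no-fixpoint {x} ¬s ¬t σx≡x =
      other-≢ blue (trans (sym (colour-of (one-out-red x ¬s ¬t))) (colour-of (one-out-blue x ¬s ¬t)))
      where
      colour-of : ∀ {c} → ExactlyOne (λ e → SameVertex x e × out e ≡ true × col e ≡ c) → col x ≡ c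
      colour-of (_ , ((k , refl) , _ , c) , _) = trans (cong col (sym (iter-fixed σ σx≡x k))) c

    -- An outgoing dart a at an inner vertex, read around the vertex in the direction ρ in
    -- which incoming darts copy the colour of their predecessor: if ρ a had the colour of a,
    -- every dart of the vertex would, leaving no outgoing dart of the other colour.
    outgoing-switches : ∀ (ρ : Fin n → Fin n) a → ¬ AtS a → ¬ AtT a →
      (∀ {y} → SameVertex a y → SameVertex a (ρ y)) →
      (∀ {y} → SameVertex a y → Reach ρ a y) →
      (∀ {y} → SameVertex a y → out y ≡ false → col (ρ y) ≡ col y) →
      out a ≡ true → col (ρ a) ≢ col a
    outgoing-switches ρ a ¬s ¬t ρ-stays ρ-reaches keeps oa ρa-same
      with e , (ae , _ , ce) , _ ← one-outgoing (other (col a)) a ¬s ¬t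
      with k , refl ← ρ-reaches ae = other-≢ (col a) (trans (sym ce) (monochrome k))
      where
      at-a : ∀ k → SameVertex a (iter ρ k a)
      at-a zero    = 0 , refl
      at-a (suc k) = ρ-stays (at-a k)

      monochrome : ∀ k → col (iter ρ k a) ≡ col a
      monochrome zero = refl
      monochrome (suc k) with out (iter ρ k a) in o
      ... | false = trans (keeps (at-a k) o) (monochrome k)
      ... | true  = trans (cong (col ∘ ρ) ρᵏa≡a) ρa-same
        where ρᵏa≡a = outgoing-unique (col a) ¬s ¬t (at-a k) o (monochrome k) (0 , refl) oa refl

    atS-keeps : ∀ {a} → AtS a → col (σ a) ≡ col a
    atS-keeps {a} s = trans (proj₂ (at-s (σ a) (vertex-trans s (vertex-σ a)))) (sym (proj₂ (at-s a s)))

    atT-keeps : ∀ {a} → AtT a → col (σ a) ≡ col a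
    atT-keeps {a} t = trans (proj₂ (at-t (σ a) (vertex-trans t (vertex-σ a)))) (sym (proj₂ (at-t a t)))

    black-incoming-keeps : ∀ {a} → black a ≡ true → out a ≡ false → col (σ a) ≡ col a
    black-incoming-keeps {a} ba oa with col (σ a) ≟ᶜ col a
    ... | yes same  = same
    ... | no differ = ⊥-elim (differ (black-rot a (differ ∘ atS-keeps) (differ ∘ atT-keeps) ba oa))

    black-outgoing-switches : ∀ {a} → black a ≡ true → out a ≡ true → col (σ a) ≢ col a
    black-outgoing-switches {a} ba oa =
      outgoing-switches σ a (outgoing-¬AtS oa) (outgoing-¬AtT oa)
        (λ ay → vertex-trans ay (vertex-σ _)) (λ ay → ay)
        (λ ay → black-incoming-keeps (trans (black-vertex ay) ba)) oa

    white-incoming-keeps : ∀ {a} → black a ≡ false → out (σ a) ≡ false → col a ≡ col (σ a)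
    white-incoming-keeps {a} ba oσa =
      trans (cong col (sym (σ-left a))) (white-rot (σ a) (white-¬AtS bσa) (white-¬AtT bσa) bσa oσa)
      where bσa = trans (black-σ a) ba

    white-outgoing-switches : ∀ {a} → black a ≡ false → out (σ a) ≡ true → col a ≢ col (σ a)
    white-outgoing-switches {a} ba oσa =
      subst (λ x → col x ≢ col (σ a)) (σ-left a)
        (outgoing-switches σ⁻ (σ a) (white-¬AtS bσa) (white-¬AtT bσa)
          (λ ay → vertex-trans ay (vertex-σ⁻ _)) σ⁻-reaches
          (λ ay → white-rot _ (white-¬AtS (bσa′ ay)) (white-¬AtT (bσa′ ay)) (bσa′ ay)) oσa)
      where
      bσa = trans (black-σ a) ba
      bσa′ : ∀ {y} → SameVertex (σ a) y → black y ≡ false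
      bσa′ ay = trans (black-vertex ay) bσa
      σ⁻-reaches : ∀ {y} → SameVertex (σ a) y → Reach σ⁻ (σ a) y
      σ⁻-reaches ay with m , σᵐy≡σa ← vertex-sym ay =
        m , trans (cong (iter σ⁻ m) (sym σᵐy≡σa)) (iter-cancel σ σ⁻ σ-left m _)

    w₁-outgoing-blue : ∀ {a} → SameVertex (φ root) a → out a ≡ true → col a ≡ blue → a ≡ α root
    w₁-outgoing-blue w₁a oa ca =
      outgoing-unique blue (white-¬AtS white-w₁) (white-¬AtT white-w₁) w₁a oa ca
        (vertex-sym (vertex-σ (α root)))
        (trans (out-α root) (cong not (proj₁ (at-s root (0 , refl)))))
        (trans (col-α root) (proj₂ (at-s root (0 , refl))))

    w₂-outgoing-red : ∀ {a} → SameVertex (iter φ 3 root) a → out a ≡ true → col a ≡ red →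
      a ≡ α (iter φ 2 root)
    w₂-outgoing-red w₂a oa ca =
      outgoing-unique red (white-¬AtS white-w₂) (white-¬AtT white-w₂) w₂a oa ca
        (vertex-sym (vertex-σ (α (iter φ 2 root))))
        (trans (out-α _) (cong not (proj₁ (at-t _ (0 , refl)))))
        (trans (col-α _) (proj₂ (at-t _ (0 , refl))))

    module _ (C : Contractible D) where

      white-incoming-blues-apart : ∀ {a} → black a ≡ false →
        out a ≡ false → col a ≡ blue → out (σ a) ≡ false → col (σ a) ≡ blue → ⊥
      white-incoming-blues-apart {a} ba oa ca oσa cσa =
        σ-no-fixpoint (white-¬AtS ba) (white-¬AtT ba)
          (exactlyOne-unique (proj₁ C a ba ¬w) (vertex-σ a , oσa , cσa) ((0 , refl) , oa , ca))
        where
        ¬w : ¬ AtW a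
        ¬w w = proj₂ C a w (oa , ca)

      -- The incoming blue dart e of the vertex is preceded by a blue dart σ⁻ e, which is not
      -- incoming (e ≠ σ⁻ e), so it is the outgoing blue dart a, and σ a = e.
      white-blue-out-then-in : ∀ {a} → black a ≡ false → ¬ AtW a →
        out a ≡ true → col a ≡ blue → out (σ a) ≡ false
      white-blue-out-then-in {a} ba ¬w oa ca
        with e , (ae , oe , ce) , e-only ← proj₁ C a ba ¬w = by-orientation (out (σ⁻ e)) refl
        where
        be = trans (black-vertex ae) ba
        ¬sₑ = white-¬AtS be
        ¬tₑ = white-¬AtT be
        cσ⁻e : col (σ⁻ e) ≡ blue
        cσ⁻e = trans (white-rot e ¬sₑ ¬tₑ be oe) ce
        by-orientation : ∀ o → out (σ⁻ e) ≡ o → out (σ a) ≡ false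
        by-orientation false oσ⁻e = ⊥-elim (σ-no-fixpoint ¬sₑ ¬tₑ
          (trans (cong σ (sym (e-only (σ⁻ e) (vertex-trans ae (vertex-σ⁻ e) , oσ⁻e , cσ⁻e)))) (σ-right e)))
        by-orientation true oσ⁻e = trans (cong (out ∘ σ) (sym σ⁻e≡a)) (trans (cong out (σ-right e)) oe)
          where
          σ⁻e≡a : σ⁻ e ≡ a
          σ⁻e≡a = outgoing-unique blue (white-¬AtS ba) (white-¬AtT ba)
                    (vertex-trans ae (vertex-σ⁻ e)) oσ⁻e cσ⁻e (0 , refl) oa ca

      white-blue-flips : ∀ {a} → black a ≡ false → σ a ≢ φ root → σ a ≢ α (iter φ 2 root) →
        col a ≡ blue → out (σ a) ≡ not (out a)
      white-blue-flips {a} ba ≢w₁ ≢w₂ ca with out a in oa | out (σ a) in oσa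
      ... | true  | false = refl
      ... | false | true  = refl
      ... | false | false =
        ⊥-elim (white-incoming-blues-apart ba oa ca oσa (trans (sym (white-incoming-keeps ba oσa)) ca))
      ... | true  | true  = ⊥-elim (not-¬ oσa (white-blue-out-then-in ba ¬w oa ca))
        where
        cσa : col (σ a) ≡ red
        cσa = ≢blue⇒red (λ cσa≡blue → white-outgoing-switches ba oσa (trans ca (sym cσa≡blue)))
        ¬w : ¬ AtW a
        ¬w (inj₁ w₁a) = ≢w₁ (cong σ (w₁-outgoing-blue w₁a oa ca))
        ¬w (inj₂ w₂a) = ≢w₂ (w₂-outgoing-red (vertex-trans w₂a (vertex-σ a)) oσa cσa)

      corner-rules : ∀ a → σ a ≢ φ root → σ a ≢ α (iter φ 2 root) →
        T (cornerᵇ (black (σ a)) (out a) (isBlue (col a)) (out (σ a)) (isBlue (col (σ a))))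
      corner-rules a ≢w₁ ≢w₂ with black (σ a) in bσa
      ... | true  = ==-intro (colour-change (black-incoming-keeps ba) (black-outgoing-switches ba))
        where ba = trans (sym (black-σ a)) bσa
      ... | false =
        ==-intro (colour-change (sym ∘ white-incoming-keeps ba) (λ o → white-outgoing-switches ba o ∘ sym))
        ,ᵀ blue-flips
        where
        ba = trans (sym (black-σ a)) bσa
        blue-flips : T (isBlue (col a) ⇒ (out (σ a) xor out a))
        blue-flips with col a in ca
        ... | red  = tt
        ... | blue rewrite white-blue-flips ba ≢w₁ ≢w₂ ca | xor-inverseˡ (out a) = tt

      face-corner : ∀ {d} → ¬ InFace root d → ¬ InFace d (α (iter φ 2 root)) →
        ∀ k → let x = iter φ k d in
        T (cornerᵇ (black (φ x)) (not (out x)) (isBlue (col x)) (out (φ x)) (isBlue (col (φ x))))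
      face-corner {d} ¬root ¬t k =
        subst₂ (λ o c → T (cornerᵇ (black (φ x)) o (isBlue c) (out (φ x)) (isBlue (col (φ x)))))
          (out-α x) (col-α x) (corner-rules (α x) ≢w₁ ≢w₂)
        where
        x = iter φ k d
        ≢w₁ : φ x ≢ φ root
        ≢w₁ φx≡w₁ = ¬root (reach-trans φ (1 , refl) (reach-sym φ {3} (face-period d) (suc k , φx≡w₁)))
        ≢w₂ : φ x ≢ α (iter φ 2 root)
        ≢w₂ φx≡αt = ¬t (suc k , φx≡αt)

    btwEdge : Fin n → Bool
    btwEdge x = btwEdgeᵇ (black x) (out x) (isBlue (col x))

    face-unique-btwEdge : Contractible D → ∀ {d} → ¬ InFace root d →
      ¬ InFace d (α (iter φ 2 root)) → ExactlyOne (λ (i : Fin 4) → T (btwEdge (iter φ (toℕ i) d)))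
    face-unique-btwEdge C {d} ¬root ¬t = exactlyOneᵇ-sound _ (⇒-elim (faceᵇ-valid labels)
      (face-alternates (x 0) ,ᵀ face-alternates (x 1) ,ᵀ face-alternates (x 2) ,ᵀ
       corner 0 ,ᵀ corner 1 ,ᵀ corner 2 ,ᵀ closing-corner))
      where
      x : ℕ → Fin n
      x k = iter φ k d
      labels : Vec Bool 12
      labels = black (x 0) ∷ out (x 0) ∷ isBlue (col (x 0)) ∷
               black (x 1) ∷ out (x 1) ∷ isBlue (col (x 1)) ∷
               black (x 2) ∷ out (x 2) ∷ isBlue (col (x 2)) ∷
               black (x 3) ∷ out (x 3) ∷ isBlue (col (x 3)) ∷ []
      corner = face-corner C ¬root ¬t
      closing-corner : T (cornerᵇ (black d) (not (out (x 3))) (isBlue (col (x 3))) (out d) (isBlue (col d)))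
      closing-corner =
        subst (λ y → T (cornerᵇ (black y) (not (out (x 3))) (isBlue (col (x 3))) (out y) (isBlue (col y))))
          (face-period d) (corner 3)

    btw⇒btwEdge : ∀ {x e} → OnEdge x e → BlackToWhiteBlue D e → T (btwEdge x)
    btw⇒btwEdge (inj₁ refl) (oe , be , ce) rewrite oe | be | ce = tt
    btw⇒btwEdge {e = e} (inj₂ refl) (oe , be , ce)
      rewrite out-α e | black-α e | col-α e | oe | be | ce = tt

    btwEdge⇒btw : ∀ x → T (btwEdge x) → Σ (Fin n) λ e → OnEdge x e × BlackToWhiteBlue D e
    btwEdge⇒btw x t with black x in bx | out x in ox | col x in cx
    ... | true  | true  | blue = x , inj₁ refl , ox , bx , cx
    ... | false | false | blue = α x , inj₂ (sym (α-invol x)) ,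
          trans (out-α x) (cong not ox) , trans (black-α x) (cong not bx) , trans (col-α x) cx
    ... | true  | false | blue = ⊥-elim t
    ... | false | true  | blue = ⊥-elim t
    ... | _     | _     | red  = ⊥-elim t

    opposite-not-both-outgoing : ∀ e → out e ≡ true → out (α e) ≡ true → ⊥
    opposite-not-both-outgoing e oe oαe with () ← trans (sym oαe) (trans (out-α e) (cong not oe))

    onEdge-btw-unique : ∀ {x e e′} → OnEdge x e → OnEdge x e′ →
      BlackToWhiteBlue D e → BlackToWhiteBlue D e′ → e ≡ e′
    onEdge-btw-unique (inj₁ refl) (inj₁ refl) _ _ = refl
    onEdge-btw-unique (inj₁ refl) (inj₂ refl) (oe , _) (oe′ , _) =
      ⊥-elim (opposite-not-both-outgoing _ oe′ oe)
    onEdge-btw-unique (inj₂ refl) (inj₁ refl) (oe , _) (oe′ , _) =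
      ⊥-elim (opposite-not-both-outgoing _ oe oe′)
    onEdge-btw-unique {e = e} {e′} (inj₂ x≡αe) (inj₂ x≡αe′) _ _ = begin
      e          ≡⟨ α-invol e ⟨
      α (α e)    ≡⟨ cong α (trans (sym x≡αe) x≡αe′) ⟩
      α (α e′)   ≡⟨ α-invol e′ ⟩
      e′         ∎
      where open ≡-Reasoning

lemma4 : {n : ℕ} (Q : Quadrangulation n) (D : SepDec Q) → Contractible D →
    (d : Fin n) → InnerFaceAfterRemoval Q d →
    Σ (Fin n) (λ e →
    (Map.InFace (Quadrangulation.M Q) d e ⊎ Map.InFace (Quadrangulation.M Q) d (Map.α (Quadrangulation.M Q) e))
    × BlackToWhiteBlue D e
    × ((e′ : Fin n) →
    (Map.InFace (Quadrangulation.M Q) d e′ ⊎ Map.InFace (Quadrangulation.M Q) d (Map.α (Quadrangulation.M Q) e′))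
    → BlackToWhiteBlue D e′ → e′ ≡ e))
lemma4 Q D C d (¬root , ¬t , _)
  with i , flagᵢ , only-i ← face-unique-btwEdge D C ¬root ¬t
  with e , e-on , e-btw ← btwEdge⇒btw D _ flagᵢ =
  e , onFace e-on , e-btw , λ e′ face′ btw′ →
    let j , e′-on = face⇒onEdge {Q = Q} face′
        j≡i = only-i j (btw⇒btwEdge D e′-on btw′)
    in onEdge-btw-unique D (subst (λ k → OnEdge {Q = Q} (dart k) e′) j≡i e′-on) e-on btw′ e-btw
  where
  open Quadrangulation Q
  dart : Fin 4 → Fin _
  dart k = iter φ (toℕ k) d
  onFace : ∀ {e} → OnEdge {Q = Q} (dart i) e → InFace d e ⊎ InFace d (α e)
  onFace (inj₁ p) = inj₁ (toℕ i , p)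
  onFace (inj₂ p) = inj₂ (toℕ i , p)
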